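{- Let $1\le k\le n-1$, $f\in\Theta_{k,n}$ and $f'\in\tilde S_n$. Suppose there is a sequence $f=f_0,f_1,\dots,f_r=f'$ in $\tilde S_n$ with $f_j=s_{i_j}f_{j-1}s_{i_j}$ for some $i_j\in\mathbb{Z}$ and $\ell(f_j)\le\ell(f_{j-1})$ for $j=1,\dots,r$. Then $f'\in\Theta_{k,n}$.
   Context: $\tilde S_n$ is the group of bijections $f:\mathbb{Z}\to\mathbb{Z}$ with $f(i+n)=f(i)+n$. $\ell(f)$ is the number of pairs $(i,j)$ with $i<j$, $f(i)>f(j)$, $i\in\{1,\dots,n\}$. $s_i$ exchanges $i+rn$ and $i+1+rn$ for all $r$ and fixes all other integers. $\Theta_{k,n}$ is the set of $f\in\tilde S_n$ with $i\le f(i)\le i+n$ for all $i$, $\sum_{i=1}^n(f(i)-i)=kn$, and induced permutation $\bar f$ of $\mathbb{Z}/n\mathbb{Z}$ an $n$-cycle. -}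

module Defs where

open import Data.Nat as ℕ using (ℕ; zero; suc)
open import Data.Nat.Divisibility as ℕD using (_∣?_)
open import Data.Integer as ℤ using (ℤ; +_; _+_; _-_; _≤_; _<_; ∣_∣)
open import Data.Integer.Divisibility as ℤD using (_∣_)
open import Data.Product using (Σ; _×_; ∃; ∃-syntax)
open import Data.List using (List; length)
open import Data.List.Membership.Propositional using (_∈_)
open import Data.List.Relation.Unary.Unique.Propositional using (Unique)
open import Function.Bundles using (_⇔_)
open import Relation.Nullary using (yes; no)
open import Relation.Binary.PropositionalEquality using (_≡_)

_≡[mod_]_ : ℤ → ℕ → ℤ → Set
a ≡[mod n ] b = (+ n) ∣ (a - b)

IsAffPerm : ℕ → (ℤ → ℤ) → Set
IsAffPerm n f =
  Σ (ℤ → ℤ) (λ g → (∀ x → g (f x) ≡ x) × (∀ x → f (g x) ≡ x))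
  × (∀ i → f (i + + n) ≡ f i + + n)

-- the simple reflection s_i (i ∈ ℤ): exchanges i+rn and i+1+rn for all r,
-- fixes all other integers (meaningful for n ≥ 2)
s : ℕ → ℤ → ℤ → ℤ
s n i x with n ∣? ∣ x - i ∣
... | yes _ = x + + 1
... | no _ with n ∣? ∣ x - (i + + 1) ∣
...   | yes _ = x - + 1
...   | no _ = x

Inversion : ℕ → (ℤ → ℤ) → ℤ × ℤ → Set
Inversion n f (i Data.Product., j) = (+ 1 ≤ i) × (i ≤ + n) × (i < j) × (f j < f i)

HasLength : ℕ → (ℤ → ℤ) → ℕ → Set
HasLength n f m =
  Σ (List (ℤ × ℤ)) λ L → Unique L × (length L ≡ m) × (∀ p → (p ∈ L) ⇔ Inversion n f p)

sumFrom1 : ℕ → (ℤ → ℤ) → ℤ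
sumFrom1 zero h = + 0
sumFrom1 (suc m) h = sumFrom1 m h + h (+ suc m)

iter : ℕ → (ℤ → ℤ) → ℤ → ℤ
iter zero f x = x
iter (suc m) f x = f (iter m f x)

-- the induced permutation f̄ of ℤ/nℤ is an n-cycle: it has a single orbit,
-- i.e. every residue class is reached from every other by iterating f̄
InducedNCycle : ℕ → (ℤ → ℤ) → Set
InducedNCycle n f = ∀ a b → ∃[ m ] (iter m f a ≡[mod n ] b)

Θ : ℕ → ℕ → (ℤ → ℤ) → Set
Θ k n f =
  IsAffPerm n f
  × (∀ i → (i ≤ f i) × (f i ≤ i + + n))
  × (sumFrom1 n (λ i → f i - i) ≡ + (k ℕ.* n))
  × InducedNCycle n f

-- By induction along the chain it suffices to treat one step g' = s g s with g ∈ Θ_{k,n} and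
-- ℓ(g') ≤ ℓ(g). Conjugation preserves the n-cycle condition, and D(g) = Σ_{x=1}^{n} (g(x) − x) is
-- additive under composition of affine permutations and vanishes on s, so D(g') = D(g) = kn.
-- Since ḡ is an n-cycle and n ≥ 2, ḡ has no fixed residue, so x < g(x) < x + n for all x. As s
-- moves every integer by at most one, g' can leave the window [x, x + n] only if g(p) = p + 1 or
-- g(p + 1) = p + n for some p ≡ i. In both cases (u, v) ↦ (s u, s v), translated back so that the
-- first entry lies in [1, n], maps the inversions of g injectively to inversions of g' and misses
-- the inversion (p, p + 1) of g' with p ∈ [1, n]; hence ℓ(g') > ℓ(g), a contradiction.

module Submission where

open import Defs
import Data.Nat.Divisibility as ℕD
import Data.Integer.Divisibility.Signed as Signed
open import Data.Nat using (ℕ; zero; suc; _≤_; _∸_)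
import Data.Nat as ℕ
import Data.Nat.Properties as ℕP
open import Data.Integer as Z using (ℤ; +_; -[1+_]; 0ℤ; 1ℤ; _+_; _-_; _*_; -_)
import Data.Integer.Properties as ZP
open import Algebra.Properties.AbelianGroup ZP.+-0-abelianGroup using () renaming (∙-cancelˡ to +-cancelˡ; ∙-cancelʳ to +-cancelʳ)
open import Data.Integer.Tactic.RingSolver using (solve-∀)
open import Data.Product using (_×_; _,_; proj₁; proj₂; ∃-syntax)
open import Data.List using (List; []; _∷_; _++_; length; map)
open import Data.List.Properties using (length-map; length-++)
open import Data.List.Membership.Propositional using (_∈_)
open import Data.List.Membership.Propositional.Properties using (∈-map⁻; ∈-∃++; ∈-++⁻; ∈-++⁺ˡ; ∈-++⁺ʳ)
open import Data.List.Relation.Unary.Any using (here; there)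
open import Data.List.Relation.Unary.All as All using (All; []; _∷_)
import Data.List.Relation.Unary.All.Properties as All
open import Data.List.Relation.Unary.AllPairs using ([]; _∷_)
open import Data.List.Relation.Unary.Unique.Propositional using (Unique)
open import Data.Sum using (_⊎_; inj₁; inj₂)
open import Data.Empty using (⊥-elim)
open import Data.Integer.DivMod using (a≡a%ℕn+[a/ℕn]*n; n%ℕd<d)
open import Function.Bundles using (Equivalence)
open import Relation.Nullary using (¬_; Dec; yes; no)
import Relation.Nullary.Decidable as Dec
open import Relation.Binary.PropositionalEquality
  using (_≡_; _≢_; refl; sym; trans; cong; cong₂; subst; subst₂; module ≡-Reasoning)

i<i+1 : ∀ i → i Z.< i + 1ℤ
i<i+1 i = ZP.≤-<-trans (ZP.≤-reflexive (sym (ZP.+-identityʳ i))) (ZP.+-monoʳ-< i (Z.+<+ (ℕ.s≤s ℕ.z≤n)))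

i-1<i : ∀ i → i - 1ℤ Z.< i
i-1<i i = ZP.<-≤-trans (ZP.+-monoʳ-< i (Z.-<+ {0} {0})) (ZP.≤-reflexive (ZP.+-identityʳ i))

i<j⇒i+1≤j : ∀ {i j} → i Z.< j → i + 1ℤ Z.≤ j
i<j⇒i+1≤j {i} i<j = subst (Z._≤ _) (ZP.+-comm 1ℤ i) (ZP.i<j⇒suc[i]≤j i<j)

i+1≤j⇒i<j : ∀ {i j} → i + 1ℤ Z.≤ j → i Z.< j
i+1≤j⇒i<j {i} i+1≤j = ZP.suc[i]≤j⇒i<j (subst (Z._≤ _) (ZP.+-comm i 1ℤ) i+1≤j)

i<j⇒i≤j-1 : ∀ {i j} → i Z.< j → i Z.≤ j - 1ℤ
i<j⇒i≤j-1 {i} {j} i<j =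
  subst (Z._≤ j - 1ℤ) (e i) (ZP.+-monoˡ-≤ (- 1ℤ) (i<j⇒i+1≤j i<j))
  where
  e : ∀ (i : ℤ) → i + 1ℤ - 1ℤ ≡ i
  e = solve-∀

i<j+1⇒i≤j : ∀ {i j} → i Z.< j + 1ℤ → i Z.≤ j
i<j+1⇒i≤j {i} {j} i<j+1 = subst (i Z.≤_) (e j) (i<j⇒i≤j-1 i<j+1)
  where
  e : ∀ (j : ℤ) → j + 1ℤ - 1ℤ ≡ j
  e = solve-∀

i<j∧j≢i+1⇒i<j-1 : ∀ {i j} → i Z.< j → j ≢ i + 1ℤ → i Z.< j - 1ℤ
i<j∧j≢i+1⇒i<j-1 i<j j≢i+1 =
  i+1≤j⇒i<j (i<j⇒i≤j-1 (ZP.≤∧≢⇒< (i<j⇒i+1≤j i<j) (λ i+1≡j → j≢i+1 (sym i+1≡j))))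

sumFrom1-cong : ∀ m {h h' : ℤ → ℤ} → (∀ x → h x ≡ h' x) → sumFrom1 m h ≡ sumFrom1 m h'
sumFrom1-cong zero    h≗h' = refl
sumFrom1-cong (suc m) h≗h' = cong₂ _+_ (sumFrom1-cong m h≗h') (h≗h' _)

sumFrom1-+ : ∀ m (h h' : ℤ → ℤ) →
  sumFrom1 m (λ x → h x + h' x) ≡ sumFrom1 m h + sumFrom1 m h'
sumFrom1-+ zero    h h' = refl
sumFrom1-+ (suc m) h h' =
  trans (cong (_+ (h (+ suc m) + h' (+ suc m))) (sumFrom1-+ m h h'))
        (e (sumFrom1 m h) (sumFrom1 m h') (h (+ suc m)) (h' (+ suc m)))
  where
  e : ∀ (a b c d : ℤ) → (a + b) + (c + d) ≡ (a + c) + (b + d)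
  e = solve-∀

sumFrom1-- : ∀ m (h h' : ℤ → ℤ) →
  sumFrom1 m (λ x → h x - h' x) ≡ sumFrom1 m h - sumFrom1 m h'
sumFrom1-- zero    h h' = refl
sumFrom1-- (suc m) h h' =
  trans (cong (_+ (h (+ suc m) - h' (+ suc m))) (sumFrom1-- m h h'))
        (e (sumFrom1 m h) (sumFrom1 m h') (h (+ suc m)) (h' (+ suc m)))
  where
  e : ∀ (a b c d : ℤ) → (a - b) + (c - d) ≡ (a + c) - (b + d)
  e = solve-∀

sumFrom1-*ʳ : ∀ m (h : ℤ → ℤ) c → sumFrom1 m (λ x → h x * c) ≡ sumFrom1 m h * c
sumFrom1-*ʳ zero    h c = refl
sumFrom1-*ʳ (suc m) h c =
  trans (cong (_+ h (+ suc m) * c) (sumFrom1-*ʳ m h c))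
        (sym (ZP.*-distribʳ-+ c (sumFrom1 m h) (h (+ suc m))))

sumFrom1-zero : ∀ m (h : ℤ → ℤ) → (∀ x → 1ℤ Z.≤ x → x Z.≤ + m → h x ≡ 0ℤ) →
  sumFrom1 m h ≡ 0ℤ
sumFrom1-zero zero    h h≡0 = refl
sumFrom1-zero (suc m) h h≡0 =
  cong₂ _+_ (sumFrom1-zero m h λ x 1≤x x≤m → h≡0 x 1≤x (ZP.≤-trans x≤m (Z.+≤+ (ℕP.n≤1+n m))))
            (h≡0 (+ suc m) (Z.+≤+ (ℕ.s≤s ℕ.z≤n)) ZP.≤-refl)

sumFrom1-swap : ∀ m k (F : ℤ → ℤ → ℤ) →
  sumFrom1 m (λ x → sumFrom1 k (F x)) ≡ sumFrom1 k (λ c → sumFrom1 m (λ x → F x c))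
sumFrom1-swap zero    k F = sym (sumFrom1-zero k (λ _ → 0ℤ) (λ _ _ _ → refl))
sumFrom1-swap (suc m) k F =
  trans (cong (_+ sumFrom1 k (F (+ suc m))) (sumFrom1-swap m k F))
        (sym (sumFrom1-+ k (λ c → sumFrom1 m (λ x → F x c)) (F (+ suc m))))

sumFrom1-single : ∀ m (h : ℤ → ℤ) x₀ → 1ℤ Z.≤ x₀ → x₀ Z.≤ + m →
  (∀ x → 1ℤ Z.≤ x → x Z.≤ + m → x ≢ x₀ → h x ≡ 0ℤ) → sumFrom1 m h ≡ h x₀
sumFrom1-single zero    h x₀ 1≤x₀ x₀≤0 _ = ⊥-elim (ZP.<-irrefl refl (ZP.<-≤-trans (i<i+1 0ℤ) (ZP.≤-trans 1≤x₀ x₀≤0)))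
sumFrom1-single (suc m) h x₀ 1≤x₀ x₀≤1+m h≡0 with x₀ ZP.≟ + suc m
... | yes refl =
  trans (cong (_+ h x₀) (sumFrom1-zero m h λ x 1≤x x≤m →
          h≡0 x 1≤x (ZP.≤-trans x≤m m≤1+m) (λ { refl → ZP.<-irrefl refl (ZP.≤-<-trans x≤m (Z.+<+ (ℕP.n<1+n m))) })))
        (ZP.+-identityˡ (h x₀))
  where
  m≤1+m : + m Z.≤ + suc m
  m≤1+m = Z.+≤+ (ℕP.n≤1+n m)
... | no x₀≢1+m =
  trans (cong₂ _+_ (sumFrom1-single m h x₀ 1≤x₀ x₀≤m λ x 1≤x x≤m → h≡0 x 1≤x (ZP.≤-trans x≤m (Z.+≤+ (ℕP.n≤1+n m))))
                   (h≡0 (+ suc m) (Z.+≤+ (ℕ.s≤s ℕ.z≤n)) ZP.≤-refl (λ 1+m≡x₀ → x₀≢1+m (sym 1+m≡x₀))))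
        (ZP.+-identityʳ (h x₀))
  where
  x₀≤m : x₀ Z.≤ + m
  x₀≤m = ZP.i<j⇒i≤pred[j] (ZP.≤∧≢⇒< x₀≤1+m x₀≢1+m)

module _ {A : Set} where

  Unique-⊆⇒length-≤ : ∀ {xs ys : List A} → Unique xs →
    (∀ {z} → z ∈ xs → z ∈ ys) → length xs ℕ.≤ length ys
  Unique-⊆⇒length-≤ {[]} _ _ = ℕ.z≤n
  Unique-⊆⇒length-≤ {x ∷ xs} (x∉xs ∷ xs!) xs⊆ys
    with pre , post , refl ← ∈-∃++ (xs⊆ys (here refl)) = begin
      suc (length xs)             ≤⟨ ℕ.s≤s (Unique-⊆⇒length-≤ xs! xs⊆pre++post) ⟩
      suc (length (pre ++ post))  ≡⟨ cong suc (length-++ pre) ⟩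
      suc (length pre ℕ.+ length post) ≡⟨ ℕP.+-suc (length pre) (length post) ⟨
      length pre ℕ.+ length (x ∷ post) ≡⟨ length-++ pre ⟨
      length (pre ++ x ∷ post)    ∎
    where
    open ℕP.≤-Reasoning
    xs⊆pre++post : ∀ {z} → z ∈ xs → z ∈ pre ++ post
    xs⊆pre++post z∈xs with ∈-++⁻ pre (xs⊆ys (there z∈xs))
    ... | inj₁ z∈pre = ∈-++⁺ˡ z∈pre
    ... | inj₂ (here refl) = ⊥-elim (All.lookup x∉xs z∈xs refl)
    ... | inj₂ (there z∈post) = ∈-++⁺ʳ pre z∈post


module _ {A B : Set} where

  InjectiveOn : (A → B) → List A → Set
  InjectiveOn f xs = ∀ {x y} → x ∈ xs → y ∈ xs → f x ≡ f y → x ≡ y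

  Unique-map⁺ : ∀ (f : A → B) {xs} → Unique xs → InjectiveOn f xs → Unique (map f xs)
  Unique-map⁺ f {[]} [] _ = []
  Unique-map⁺ f {x ∷ xs} (x∉xs ∷ xs!) inj =
    All.map⁺ (All.tabulate λ y∈xs fx≡fy → All.lookup x∉xs y∈xs (inj (here refl) (there y∈xs) fx≡fy))
    ∷ Unique-map⁺ f xs! (λ x∈xs y∈xs → inj (there x∈xs) (there y∈xs))

  length-<-by-injection : ∀ (f : A → B) {xs ys e} → Unique xs → InjectiveOn f xs →
    (∀ {x} → x ∈ xs → f x ∈ ys) → e ∈ ys → (∀ {x} → x ∈ xs → f x ≢ e) →
    length xs ℕ.< length ys
  length-<-by-injection f {xs} {ys} {e} xs! inj f∈ys e∈ys f≢e =
    subst (ℕ._≤ length ys) (cong suc (length-map f xs))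
      (Unique-⊆⇒length-≤ (e∉image ∷ Unique-map⁺ f xs! inj) image⊆ys)
    where
    e∉image : All (e ≢_) (map f xs)
    e∉image = All.map⁺ (All.tabulate λ x∈xs e≡fx → f≢e x∈xs (sym e≡fx))
    image⊆ys : ∀ {z} → z ∈ e ∷ map f xs → z ∈ ys
    image⊆ys (here refl) = e∈ys
    image⊆ys (there z∈image) with _ , x∈xs , refl ← ∈-map⁻ f z∈image = f∈ys x∈xs

module AffineSymmetricGroup (n : ℕ) (1<n : 1 ℕ.< n) where

  instance
    n-nonZero : ℕ.NonZero n
    n-nonZero = ℕ.>-nonZero (ℕP.<-trans (ℕ.s≤s ℕ.z≤n) 1<n)

  N : ℤ
  N = + n

  -- Congruence modulo n and residues in [1, n]

  -- x ≡[mod n ] y with the quotient made explicit, so that it can be eliminated by matching on refl.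
  infix 4 _≈_
  record _≈_ (x y : ℤ) : Set where
    constructor _,_
    field
      quotient : ℤ
      equation : x ≡ y + quotient * N

  ≈-refl : ∀ {x} → x ≈ x
  ≈-refl {x} = 0ℤ , e x N
    where
    e : ∀ (x N : ℤ) → x ≡ x + 0ℤ * N
    e = solve-∀

  ≈-sym : ∀ {x y} → x ≈ y → y ≈ x
  ≈-sym {y = y} (t , refl) = - t , e y t N
    where
    e : ∀ (y t N : ℤ) → y ≡ (y + t * N) + - t * N
    e = solve-∀

  ≈-trans : ∀ {x y z} → x ≈ y → y ≈ z → x ≈ z
  ≈-trans {z = z} (t , refl) (u , refl) = u + t , e z u t N
    where
    e : ∀ (z u t N : ℤ) → (z + u * N) + t * N ≡ z + (u + t) * N
    e = solve-∀

  ≈-reflexive : ∀ {x y} → x ≡ y → x ≈ y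
  ≈-reflexive refl = ≈-refl

  +-congʳ-≈ : ∀ {x y} c → x ≈ y → x + c ≈ y + c
  +-congʳ-≈ {y = y} c (t , refl) = t , e y t N c
    where
    e : ∀ (y t N c : ℤ) → (y + t * N) + c ≡ (y + c) + t * N
    e = solve-∀

  +-cancelʳ-≈ : ∀ {x y} c → x + c ≈ y + c → x ≈ y
  +-cancelʳ-≈ {x} {y} c (t , eq) = t , (begin
    x                 ≡⟨ e₁ x c ⟩
    x + c - c         ≡⟨ cong (_- c) eq ⟩
    y + c + t * N - c ≡⟨ e₂ y t N c ⟩
    y + t * N         ∎)
    where
    open ≡-Reasoning
    e₁ : ∀ (x c : ℤ) → x ≡ x + c - c
    e₁ = solve-∀
    e₂ : ∀ (y t N c : ℤ) → y + c + t * N - c ≡ y + t * N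
    e₂ = solve-∀

  x+N≈x : ∀ x → x + N ≈ x
  x+N≈x x = 1ℤ , cong (λ w → x + w) (sym (ZP.*-identityˡ N))

  x+1≉x : ∀ x → ¬ x + 1ℤ ≈ x
  x+1≉x x (t , eq) = ℕP.<-irrefl (sym n≡1) 1<n
    where
    1≡tN : 1ℤ ≡ t * N
    1≡tN = +-cancelˡ x 1ℤ (t * N) eq
    n≡1 : n ≡ 1
    n≡1 = ℕP.m*n≡1⇒n≡1 Z.∣ t ∣ n (trans (sym (ZP.abs-* t N)) (cong Z.∣_∣ (sym 1≡tN)))

  ≡[mod]⇒≈ : ∀ {x y} → x ≡[mod n ] y → x ≈ y
  ≡[mod]⇒≈ {x} {y} n∣x-y with Signed.divides t x-y≡tN ← Signed.∣ᵤ⇒∣ n∣x-y =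
    t , trans (e x y) (cong (λ w → y + w) x-y≡tN)
    where
    e : ∀ (x y : ℤ) → x ≡ y + (x - y)
    e = solve-∀

  ≈⇒≡[mod] : ∀ {x y} → x ≈ y → x ≡[mod n ] y
  ≈⇒≡[mod] {y = y} (t , refl) = Signed.∣⇒∣ᵤ (Signed.divides t (e y t N))
    where
    e : ∀ (y t N : ℤ) → y + t * N - y ≡ t * N
    e = solve-∀

  _≈?_ : ∀ x y → Dec (x ≈ y)
  x ≈? y = Dec.map′ ≡[mod]⇒≈ ≈⇒≡[mod] (n ℕD.∣? Z.∣ x - y ∣)

  InRange : ℤ → Set
  InRange x = 1ℤ Z.≤ x × x Z.≤ N

  residue : ℤ → ℤ
  residue y = + ((y - 1ℤ) Z.%ℕ n) + 1ℤ

  ≈-residue : ∀ y → y ≈ residue y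
  ≈-residue y = (y - 1ℤ) Z./ℕ n , (begin
    y                                 ≡⟨ e₁ y ⟩
    (y - 1ℤ) + 1ℤ                     ≡⟨ cong (_+ 1ℤ) (a≡a%ℕn+[a/ℕn]*n (y - 1ℤ) n) ⟩
    (+ r + (y - 1ℤ) Z./ℕ n * N) + 1ℤ  ≡⟨ e₂ (+ r) ((y - 1ℤ) Z./ℕ n) N ⟩
    (+ r + 1ℤ) + (y - 1ℤ) Z./ℕ n * N  ∎)
    where
    open ≡-Reasoning
    r : ℕ
    r = (y - 1ℤ) Z.%ℕ n
    e₁ : ∀ (y : ℤ) → y ≡ (y - 1ℤ) + 1ℤ
    e₁ = solve-∀
    e₂ : ∀ (r q N : ℤ) → (r + q * N) + 1ℤ ≡ (r + 1ℤ) + q * N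
    e₂ = solve-∀

  InRange-residue : ∀ y → InRange (residue y)
  InRange-residue y =
    subst (1ℤ Z.≤_) (ZP.+-comm 1ℤ (+ r)) (ZP.i≤i+j 1ℤ (+ r)) ,
    subst (Z._≤ N) (ZP.pos-+ r 1) (Z.+≤+ (subst (ℕ._≤ n) (ℕP.+-comm 1 r) (n%ℕd<d (y - 1ℤ) n)))
    where
    r : ℕ
    r = (y - 1ℤ) Z.%ℕ n

  N≤[1+q]*N : ∀ q → N Z.≤ + suc q * N
  N≤[1+q]*N q = subst (N Z.≤_) (ZP.pos-* (suc q) n) (Z.+≤+ (ℕP.m≤m+n n (q ℕ.* n)))

  InRange-≈⇒≡ : ∀ {c c'} → InRange c → InRange c' → c ≈ c' → c ≡ c'
  InRange-≈⇒≡ {c' = c'} _ _ (+ 0 , refl) = e c' N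
    where
    e : ∀ (c N : ℤ) → c + 0ℤ * N ≡ c
    e = solve-∀
  InRange-≈⇒≡ {c' = c'} (_ , c≤N) (1≤c' , _) (+ suc q , refl) = ⊥-elim (ZP.<-irrefl refl (begin-strict
    N                   <⟨ i<i+1 N ⟩
    N + 1ℤ              ≡⟨ ZP.+-comm N 1ℤ ⟩
    1ℤ + N              ≤⟨ ZP.+-mono-≤ 1≤c' (N≤[1+q]*N q) ⟩
    c' + + suc q * N    ≤⟨ c≤N ⟩
    N                   ∎))
    where open ZP.≤-Reasoning
  InRange-≈⇒≡ {c' = c'} (1≤c , _) (_ , c'≤N) (-[1+ q ] , refl) = ⊥-elim (ZP.<-irrefl refl (begin-strict
    0ℤ                  <⟨ Z.+<+ (ℕ.s≤s ℕ.z≤n) ⟩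
    1ℤ                  ≤⟨ 1≤c ⟩
    c' + -[1+ q ] * N   ≡⟨ cong (λ w → c' + w) (ZP.neg-distribˡ-* (+ suc q) N) ⟨
    c' + - (+ suc q * N) ≤⟨ ZP.+-mono-≤ c'≤N (ZP.neg-mono-≤ (N≤[1+q]*N q)) ⟩
    N - N               ≡⟨ ZP.+-inverseʳ N ⟩
    0ℤ                  ∎))
    where open ZP.≤-Reasoning

  -- Affine permutations and sums over a period

  shift-multiple : ∀ (h : ℤ → ℤ) c → (∀ x → h (x + N) ≡ h x + c) →
    ∀ x t → h (x + t * N) ≡ h x + t * c
  shift-multiple h c h-shift x (+ q) = shift-pos q x
    where
    shift-pos : ∀ q x → h (x + + q * N) ≡ h x + + q * c
    shift-pos 0 x = trans (cong h (e x N)) (sym (e (h x) c))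
      where
      e : ∀ (x N : ℤ) → x + 0ℤ * N ≡ x
      e = solve-∀
    shift-pos (suc q) x = begin
      h (x + (1ℤ + + q) * N)      ≡⟨ cong h (e₁ x (+ q) N) ⟩
      h ((x + + q * N) + N)       ≡⟨ h-shift _ ⟩
      h (x + + q * N) + c         ≡⟨ cong (_+ c) (shift-pos q x) ⟩
      (h x + + q * c) + c         ≡⟨ e₂ (h x) (+ q) c ⟩
      h x + (1ℤ + + q) * c        ∎
      where
      open ≡-Reasoning
      e₁ : ∀ (x q N : ℤ) → x + (1ℤ + q) * N ≡ (x + q * N) + N
      e₁ = solve-∀
      e₂ : ∀ (y q c : ℤ) → (y + q * c) + c ≡ y + (1ℤ + q) * c
      e₂ = solve-∀
  shift-multiple h c h-shift x -[1+ q ] = begin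
    h y                                    ≡⟨ e₁ (h y) (+ suc q * c) ⟩
    (h y + + suc q * c) - + suc q * c      ≡⟨ cong (_- + suc q * c) (shift-multiple h c h-shift y (+ suc q)) ⟨
    h (y + + suc q * N) - + suc q * c      ≡⟨ cong (λ w → h w - + suc q * c) (e₂ x (+ suc q) N) ⟩
    h x - + suc q * c                      ≡⟨ cong (λ w → h x + w) (ZP.neg-distribˡ-* (+ suc q) c) ⟩
    h x + -[1+ q ] * c                     ∎
    where
    open ≡-Reasoning
    y : ℤ
    y = x + -[1+ q ] * N
    e₁ : ∀ (a b : ℤ) → a ≡ (a + b) - b
    e₁ = solve-∀
    e₂ : ∀ (x t N : ℤ) → (x + (- t) * N) + t * N ≡ x
    e₂ = solve-∀

  module AffPerm {g : ℤ → ℤ} (g-aff : IsAffPerm n g) where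

    inverse : ℤ → ℤ
    inverse = proj₁ (proj₁ g-aff)

    inverse-left : ∀ x → inverse (g x) ≡ x
    inverse-left = proj₁ (proj₂ (proj₁ g-aff))

    inverse-right : ∀ x → g (inverse x) ≡ x
    inverse-right = proj₂ (proj₂ (proj₁ g-aff))

    periodic : ∀ x → g (x + N) ≡ g x + N
    periodic = proj₂ g-aff

    shift : ∀ x t → g (x + t * N) ≡ g x + t * N
    shift = shift-multiple g N periodic

    resp-≈ : ∀ {x y} → x ≈ y → g x ≈ g y
    resp-≈ {y = y} (t , refl) = t , shift y t

    ≈-injective : ∀ {x y} → g x ≈ g y → x ≈ y
    ≈-injective {x} {y} (t , gx≡gy+tN) = t , (begin
      x                      ≡⟨ inverse-left x ⟨
      inverse (g x)          ≡⟨ cong inverse (trans gx≡gy+tN (sym (shift y t))) ⟩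
      inverse (g (y + t * N)) ≡⟨ inverse-left _ ⟩
      y + t * N              ∎)
      where open ≡-Reasoning

    displacement-resp-≈ : ∀ {x y} → x ≈ y → g x - x ≡ g y - y
    displacement-resp-≈ {y = y} (t , refl) =
      trans (cong (_- (y + t * N)) (shift y t)) (e (g y) y t N)
      where
      e : ∀ (gy y t N : ℤ) → (gy + t * N) - (y + t * N) ≡ gy - y
      e = solve-∀

    displacement-on-class : ∀ {x p c} → x ≈ p → g p ≡ p + c → g x ≡ x + c
    displacement-on-class {x} {p} {c} x≈p gp≡p+c = begin
      g x                ≡⟨ e (g x) x ⟩
      x + (g x - x)      ≡⟨ cong (λ w → x + w) (displacement-resp-≈ x≈p) ⟩
      x + (g p - p)      ≡⟨ cong (λ w → x + (w - p)) gp≡p+c ⟩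
      x + (p + c - p)    ≡⟨ cong (λ w → x + w) (e' p c) ⟩
      x + c              ∎
      where
      open ≡-Reasoning
      e : ∀ (a x : ℤ) → a ≡ x + (a - x)
      e = solve-∀
      e' : ∀ (p c : ℤ) → p + c - p ≡ c
      e' = solve-∀

    shift⁻ : ∀ x t → g (x - t * N) ≡ g x - t * N
    shift⁻ x t = begin
      g (x - t * N)      ≡⟨ cong g (e x t N) ⟩
      g (x + - t * N)    ≡⟨ shift x (- t) ⟩
      g x + - t * N      ≡⟨ e (g x) t N ⟨
      g x - t * N        ∎
      where
      open ≡-Reasoning
      e : ∀ (x t N : ℤ) → x - t * N ≡ x + - t * N
      e = solve-∀

  IsAffPerm-id : IsAffPerm n (λ x → x)
  IsAffPerm-id = ((λ x → x) , (λ _ → refl) , (λ _ → refl)) , (λ _ → refl)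

  IsAffPerm-∘ : ∀ {g h} → IsAffPerm n g → IsAffPerm n h → IsAffPerm n (λ x → g (h x))
  IsAffPerm-∘ {g} {h} g-aff h-aff =
    ((λ x → H.inverse (G.inverse x)) ,
     (λ x → trans (cong H.inverse (G.inverse-left (h x))) (H.inverse-left x)) ,
     (λ x → trans (cong g (H.inverse-right (G.inverse x))) (G.inverse-right x))) ,
    (λ x → trans (cong g (H.periodic x)) (G.periodic (h x)))
    where
    module G = AffPerm g-aff
    module H = AffPerm h-aff

  IsAffPerm-resp-≗ : ∀ {g h} → (∀ x → g x ≡ h x) → IsAffPerm n g → IsAffPerm n h
  IsAffPerm-resp-≗ {g} {h} g≗h g-aff =
    (G.inverse ,
     (λ x → trans (cong G.inverse (sym (g≗h x))) (G.inverse-left x)) ,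
     (λ x → trans (sym (g≗h _)) (G.inverse-right x))) ,
    (λ x → trans (sym (g≗h _)) (trans (G.periodic x) (cong (_+ N) (g≗h x))))
    where
    module G = AffPerm g-aff

  indicator : ℤ → ℤ → ℤ
  indicator c y with y ≈? c
  ... | yes _ = 1ℤ
  ... | no  _ = 0ℤ

  indicator-≈ : ∀ {c y} → y ≈ c → indicator c y ≡ 1ℤ
  indicator-≈ {c} {y} y≈c with y ≈? c
  ... | yes _   = refl
  ... | no  y≉c = ⊥-elim (y≉c y≈c)

  indicator-≉ : ∀ {c y} → ¬ y ≈ c → indicator c y ≡ 0ℤ
  indicator-≉ {c} {y} y≉c with y ≈? c
  ... | yes y≈c = ⊥-elim (y≉c y≈c)
  ... | no  _   = refl

  sum-indicator-∘ : ∀ {U} → IsAffPerm n U → ∀ c → sumFrom1 n (λ x → indicator c (U x)) ≡ 1ℤ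
  sum-indicator-∘ {U} U-aff c =
    trans (sumFrom1-single n (λ x → indicator c (U x)) x₀ 1≤x₀ x₀≤N vanishes) (indicator-≈ Ux₀≈c)
    where
    open AffPerm U-aff
    x₀ : ℤ
    x₀ = residue (inverse c)
    1≤x₀ : 1ℤ Z.≤ x₀
    1≤x₀ = proj₁ (InRange-residue (inverse c))
    x₀≤N : x₀ Z.≤ N
    x₀≤N = proj₂ (InRange-residue (inverse c))
    Ux₀≈c : U x₀ ≈ c
    Ux₀≈c = subst (U x₀ ≈_) (inverse-right c) (resp-≈ (≈-sym (≈-residue (inverse c))))
    vanishes : ∀ x → 1ℤ Z.≤ x → x Z.≤ N → x ≢ x₀ → indicator c (U x) ≡ 0ℤ
    vanishes x 1≤x x≤N x≢x₀ = indicator-≉ λ Ux≈c →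
      x≢x₀ (InRange-≈⇒≡ (1≤x , x≤N) (1≤x₀ , x₀≤N) (≈-injective (≈-trans Ux≈c (≈-sym Ux₀≈c))))

  Periodic : (ℤ → ℤ) → Set
  Periodic p = ∀ y → p (y + N) ≡ p y

  Periodic-resp-≈ : ∀ {p} → Periodic p → ∀ {y y'} → y ≈ y' → p y ≡ p y'
  Periodic-resp-≈ {p} p-per {y' = y'} (t , refl) = begin
    p (y' + t * N)  ≡⟨ shift-multiple p 0ℤ (λ y → trans (p-per y) (sym (ZP.+-identityʳ (p y)))) y' t ⟩
    p y' + t * 0ℤ   ≡⟨ cong (λ w → p y' + w) (ZP.*-zeroʳ t) ⟩
    p y' + 0ℤ       ≡⟨ ZP.+-identityʳ (p y') ⟩
    p y'            ∎
    where open ≡-Reasoning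

  -- Expand p y = Σ_{c=1}^{n} [y ≡ c] p c and exchange the order of summation; each residue c is
  -- hit by exactly one U x with x ∈ [1, n].
  sumFrom1-reindex : ∀ {U} → IsAffPerm n U → ∀ {p} → Periodic p →
    sumFrom1 n (λ x → p (U x)) ≡ sumFrom1 n p
  sumFrom1-reindex {U} U-aff {p} p-per = begin
    sumFrom1 n (λ x → p (U x))                                     ≡⟨ sumFrom1-cong n (λ x → expand (U x)) ⟩
    sumFrom1 n (λ x → sumFrom1 n (λ c → indicator c (U x) * p c)) ≡⟨ sumFrom1-swap n n _ ⟩
    sumFrom1 n (λ c → sumFrom1 n (λ x → indicator c (U x) * p c)) ≡⟨ sumFrom1-cong n collapse ⟩
    sumFrom1 n p                                                   ∎
    where
    open ≡-Reasoning
    expand : ∀ y → p y ≡ sumFrom1 n (λ c → indicator c y * p c)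
    expand y = sym (begin
      sumFrom1 n (λ c → indicator c y * p c)  ≡⟨ sumFrom1-single n _ (residue y) 1≤r r≤N vanishes ⟩
      indicator (residue y) y * p (residue y) ≡⟨ cong (_* p (residue y)) (indicator-≈ (≈-residue y)) ⟩
      1ℤ * p (residue y)                      ≡⟨ ZP.*-identityˡ _ ⟩
      p (residue y)                           ≡⟨ Periodic-resp-≈ p-per (≈-residue y) ⟨
      p y                                     ∎)
      where
      1≤r : 1ℤ Z.≤ residue y
      1≤r = proj₁ (InRange-residue y)
      r≤N : residue y Z.≤ N
      r≤N = proj₂ (InRange-residue y)
      vanishes : ∀ c → 1ℤ Z.≤ c → c Z.≤ N → c ≢ residue y → indicator c y * p c ≡ 0ℤ
      vanishes c 1≤c c≤N c≢r = trans (cong (_* p c) (indicator-≉ λ y≈c →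
          c≢r (InRange-≈⇒≡ (1≤c , c≤N) (1≤r , r≤N) (≈-trans (≈-sym y≈c) (≈-residue y)))))
        (ZP.*-zeroˡ (p c))
    collapse : ∀ c → sumFrom1 n (λ x → indicator c (U x) * p c) ≡ p c
    collapse c = begin
      sumFrom1 n (λ x → indicator c (U x) * p c)  ≡⟨ sumFrom1-*ʳ n _ (p c) ⟩
      sumFrom1 n (λ x → indicator c (U x)) * p c  ≡⟨ cong (_* p c) (sum-indicator-∘ U-aff c) ⟩
      1ℤ * p c                                    ≡⟨ ZP.*-identityˡ (p c) ⟩
      p c                                         ∎

  displacement : (ℤ → ℤ) → ℤ
  displacement h = sumFrom1 n (λ x → h x - x)

  displacement-∘ : ∀ {g h} → IsAffPerm n g → IsAffPerm n h →
    displacement (λ x → g (h x)) ≡ displacement g + displacement h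
  displacement-∘ {g} {h} g-aff h-aff = begin
    sumFrom1 n (λ x → g (h x) - x)                            ≡⟨ sumFrom1-cong n (λ x → e (g (h x)) (h x) x) ⟩
    sumFrom1 n (λ x → (g (h x) - h x) + (h x - x))            ≡⟨ sumFrom1-+ n _ _ ⟩
    sumFrom1 n (λ x → g (h x) - h x) + displacement h         ≡⟨ cong (_+ displacement h) (sumFrom1-reindex h-aff g-per) ⟩
    displacement g + displacement h                           ∎
    where
    open ≡-Reasoning
    e : ∀ (a b c : ℤ) → a - c ≡ (a - b) + (b - c)
    e = solve-∀
    g-per : Periodic (λ y → g y - y)
    g-per y = AffPerm.displacement-resp-≈ g-aff (x+N≈x y)

  -- The n-cycle condition and the window x ≤ g(x) ≤ x + n

  InWindow : ℤ → ℤ → Set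
  InWindow x w = x Z.≤ w × w Z.≤ x + N

  StrictWindow : (ℤ → ℤ) → Set
  StrictWindow g = ∀ x → x Z.< g x × g x Z.< x + N

  InducedNCycle-conjugate : ∀ {U g g'} (U-aff : IsAffPerm n U) →
    (∀ x → g' x ≡ U (g (AffPerm.inverse U-aff x))) → InducedNCycle n g → InducedNCycle n g'
  InducedNCycle-conjugate {U} {g} {g'} U-aff g'≗UgV g-cycle a b =
    m , ≈⇒≡[mod] (subst₂ _≈_ (sym (iter-conj m a)) (inverse-right b) (resp-≈ (≡[mod]⇒≈ Vaₘ≡Vb)))
    where
    open AffPerm U-aff
    m : ℕ
    m = proj₁ (g-cycle (inverse a) (inverse b))
    Vaₘ≡Vb : iter m g (inverse a) ≡[mod n ] inverse b
    Vaₘ≡Vb = proj₂ (g-cycle (inverse a) (inverse b))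
    iter-conj : ∀ m a → iter m g' a ≡ U (iter m g (inverse a))
    iter-conj zero    a = sym (inverse-right a)
    iter-conj (suc m) a = begin
      g' (iter m g' a)                             ≡⟨ g'≗UgV _ ⟩
      U (g (inverse (iter m g' a)))                ≡⟨ cong (λ w → U (g (inverse w))) (iter-conj m a) ⟩
      U (g (inverse (U (iter m g (inverse a)))))   ≡⟨ cong (λ w → U (g w)) (inverse-left _) ⟩
      U (g (iter m g (inverse a)))                 ∎
      where open ≡-Reasoning

  InducedNCycle⇒no-fixed-residue : ∀ {g} → IsAffPerm n g → InducedNCycle n g → ∀ y → ¬ g y ≈ y
  InducedNCycle⇒no-fixed-residue {g} g-aff g-cycle y gy≈y
    with m , yₘ≡y+1 ← g-cycle y (y + 1ℤ) =
    x+1≉x y (≈-trans (≈-sym (≡[mod]⇒≈ yₘ≡y+1)) (orbit≈ m))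
    where
    orbit≈ : ∀ m → iter m g y ≈ y
    orbit≈ zero    = ≈-refl
    orbit≈ (suc m) = ≈-trans (AffPerm.resp-≈ g-aff (orbit≈ m)) gy≈y

  Θ⇒StrictWindow : ∀ {k g} → Θ k n g → StrictWindow g
  Θ⇒StrictWindow {g = g} (g-aff , g-window , _ , g-cycle) x =
    ZP.≤∧≢⇒< (proj₁ (g-window x)) (λ x≡gx → no-fixed (≈-reflexive (sym x≡gx))) ,
    ZP.≤∧≢⇒< (proj₂ (g-window x)) (λ gx≡x+N → no-fixed (≈-trans (≈-reflexive gx≡x+N) (x+N≈x x)))
    where
    no-fixed : ¬ g x ≈ x
    no-fixed = InducedNCycle⇒no-fixed-residue g-aff g-cycle x

  Θ-resp-≗ : ∀ {k g h} → (∀ x → g x ≡ h x) → Θ k n g → Θ k n h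
  Θ-resp-≗ {g = g} {h} g≗h (g-aff , g-window , g-displacement , g-cycle) =
    IsAffPerm-resp-≗ g≗h g-aff ,
    (λ x → subst (InWindow x) (g≗h x) (g-window x)) ,
    trans (sym (sumFrom1-cong n (λ x → cong (_- x) (g≗h x)))) g-displacement ,
    InducedNCycle-conjugate IsAffPerm-id (λ x → sym (g≗h x)) g-cycle

  -- The simple reflection s_i

  module Reflection (i : ℤ) where

    S : ℤ → ℤ
    S = s n i

    i+1≉i : ∀ {x} → x ≈ i → ¬ x ≈ i + 1ℤ
    i+1≉i x≈i x≈i+1 = x+1≉x i (≈-trans (≈-sym x≈i+1) x≈i)

    S-at-i : ∀ {x} → x ≈ i → S x ≡ x + 1ℤ
    S-at-i {x} x≈i with n ℕD.∣? Z.∣ x - i ∣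
    ... | yes _    = refl
    ... | no  x≉i  = ⊥-elim (x≉i (≈⇒≡[mod] x≈i))

    S-at-i+1 : ∀ {x} → x ≈ i + 1ℤ → S x ≡ x - 1ℤ
    S-at-i+1 {x} x≈i+1 with n ℕD.∣? Z.∣ x - i ∣
    ... | yes x≈i = ⊥-elim (i+1≉i (≡[mod]⇒≈ x≈i) x≈i+1)
    ... | no  _ with n ℕD.∣? Z.∣ x - (i + 1ℤ) ∣
    ...   | yes _     = refl
    ...   | no  x≉i+1 = ⊥-elim (x≉i+1 (≈⇒≡[mod] x≈i+1))

    S-elsewhere : ∀ {x} → ¬ x ≈ i → ¬ x ≈ i + 1ℤ → S x ≡ x
    S-elsewhere {x} x≉i x≉i+1 with n ℕD.∣? Z.∣ x - i ∣
    ... | yes x≈i = ⊥-elim (x≉i (≡[mod]⇒≈ x≈i))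
    ... | no  _ with n ℕD.∣? Z.∣ x - (i + 1ℤ) ∣
    ...   | yes x≈i+1 = ⊥-elim (x≉i+1 (≡[mod]⇒≈ x≈i+1))
    ...   | no  _     = refl

    data Position (x : ℤ) : Set where
      at-i      : x ≈ i → Position x
      at-i+1    : x ≈ i + 1ℤ → Position x
      elsewhere : ¬ x ≈ i → ¬ x ≈ i + 1ℤ → Position x

    position : ∀ x → Position x
    position x with x ≈? i | x ≈? (i + 1ℤ)
    ... | yes x≈i | _         = at-i x≈i
    ... | no  _   | yes x≈i+1 = at-i+1 x≈i+1
    ... | no x≉i  | no x≉i+1  = elsewhere x≉i x≉i+1

    -1≈i : ∀ {x} → x ≈ i + 1ℤ → x - 1ℤ ≈ i
    -1≈i {x} x≈i+1 = +-cancelʳ-≈ 1ℤ (subst (_≈ i + 1ℤ) (e x) x≈i+1)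
      where
      e : ∀ (x : ℤ) → x ≡ x - 1ℤ + 1ℤ
      e = solve-∀

    S[x+1]≡x : ∀ {x} → x ≈ i → S (x + 1ℤ) ≡ x
    S[x+1]≡x {x} x≈i = trans (S-at-i+1 (+-congʳ-≈ 1ℤ x≈i)) (e x)
      where
      e : ∀ (x : ℤ) → x + 1ℤ - 1ℤ ≡ x
      e = solve-∀

    S-involutive : ∀ x → S (S x) ≡ x
    S-involutive x with position x
    ... | at-i x≈i = trans (cong S (S-at-i x≈i)) (S[x+1]≡x x≈i)
    ... | at-i+1 x≈i+1 = begin
      S (S x)          ≡⟨ cong S (S-at-i+1 x≈i+1) ⟩
      S (x - 1ℤ)       ≡⟨ S-at-i (-1≈i x≈i+1) ⟩
      x - 1ℤ + 1ℤ      ≡⟨ e x ⟩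
      x                ∎
      where
      open ≡-Reasoning
      e : ∀ (x : ℤ) → x - 1ℤ + 1ℤ ≡ x
      e = solve-∀
    ... | elsewhere x≉i x≉i+1 = trans (cong S (S-elsewhere x≉i x≉i+1)) (S-elsewhere x≉i x≉i+1)

    S-periodic : ∀ x → S (x + N) ≡ S x + N
    S-periodic x with position x
    ... | at-i x≈i = trans (S-at-i (≈-trans (x+N≈x x) x≈i))
                           (trans (e x N) (cong (_+ N) (sym (S-at-i x≈i))))
      where
      e : ∀ (x N : ℤ) → x + N + 1ℤ ≡ x + 1ℤ + N
      e = solve-∀
    ... | at-i+1 x≈i+1 = trans (S-at-i+1 (≈-trans (x+N≈x x) x≈i+1))
                               (trans (e x N) (cong (_+ N) (sym (S-at-i+1 x≈i+1))))
      where
      e : ∀ (x N : ℤ) → x + N - 1ℤ ≡ x - 1ℤ + N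
      e = solve-∀
    ... | elsewhere x≉i x≉i+1 =
      trans (S-elsewhere (λ x+N≈i → x≉i (≈-trans (≈-sym (x+N≈x x)) x+N≈i))
                         (λ x+N≈i+1 → x≉i+1 (≈-trans (≈-sym (x+N≈x x)) x+N≈i+1)))
            (cong (_+ N) (sym (S-elsewhere x≉i x≉i+1)))

    IsAffPerm-S : IsAffPerm n S
    IsAffPerm-S = (S , S-involutive , S-involutive) , S-periodic

    S≤x+1 : ∀ x → S x Z.≤ x + 1ℤ
    S≤x+1 x with position x
    ... | at-i x≈i            = ZP.≤-reflexive (S-at-i x≈i)
    ... | at-i+1 x≈i+1        = subst (Z._≤ x + 1ℤ) (sym (S-at-i+1 x≈i+1))
                                  (ZP.<⇒≤ (ZP.<-trans (i-1<i x) (i<i+1 x)))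
    ... | elsewhere x≉i x≉i+1 = subst (Z._≤ x + 1ℤ) (sym (S-elsewhere x≉i x≉i+1)) (ZP.<⇒≤ (i<i+1 x))

    x-1≤S : ∀ x → x - 1ℤ Z.≤ S x
    x-1≤S x with position x
    ... | at-i x≈i            = subst (x - 1ℤ Z.≤_) (sym (S-at-i x≈i))
                                  (ZP.<⇒≤ (ZP.<-trans (i-1<i x) (i<i+1 x)))
    ... | at-i+1 x≈i+1        = ZP.≤-reflexive (sym (S-at-i+1 x≈i+1))
    ... | elsewhere x≉i x≉i+1 = subst (x - 1ℤ Z.≤_) (sym (S-elsewhere x≉i x≉i+1)) (ZP.<⇒≤ (i-1<i x))

    S≤x : ∀ {x} → ¬ x ≈ i → S x Z.≤ x
    S≤x {x} x≉i with position x
    ... | at-i x≈i            = ⊥-elim (x≉i x≈i)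
    ... | at-i+1 x≈i+1        = subst (Z._≤ x) (sym (S-at-i+1 x≈i+1)) (ZP.<⇒≤ (i-1<i x))
    ... | elsewhere x≉i x≉i+1 = ZP.≤-reflexive (S-elsewhere x≉i x≉i+1)

    S-inside : ∀ {x z} → x Z.< z → z Z.< x + N → InWindow x (S z)
    S-inside x<z z<x+N =
      ZP.≤-trans (i<j⇒i≤j-1 x<z) (x-1≤S _) , ZP.≤-trans (S≤x+1 _) (i<j⇒i+1≤j z<x+N)

    <S : ∀ {c b} → c Z.< b → (b ≈ i + 1ℤ → b ≢ c + 1ℤ) → c Z.< S b
    <S {c} {b} c<b exception with position b
    ... | at-i b≈i            = subst (c Z.<_) (sym (S-at-i b≈i)) (ZP.<-trans c<b (i<i+1 b))
    ... | at-i+1 b≈i+1        = subst (c Z.<_) (sym (S-at-i+1 b≈i+1))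
                                  (i<j∧j≢i+1⇒i<j-1 c<b (exception b≈i+1))
    ... | elsewhere b≉i b≉i+1 = subst (c Z.<_) (sym (S-elsewhere b≉i b≉i+1)) c<b

    S-<-mono : ∀ {a b} → a Z.< b → ¬ (a ≈ i × b ≡ a + 1ℤ) → S a Z.< S b
    S-<-mono {a} {b} a<b not-swapped with a ≈? i
    ... | yes a≈i = subst (Z._< S b) (sym (S-at-i a≈i)) (<S a+1<b b≢a+2)
      where
      a+1<b : a + 1ℤ Z.< b
      a+1<b = ZP.≤∧≢⇒< (i<j⇒i+1≤j a<b) (λ a+1≡b → not-swapped (a≈i , sym a+1≡b))
      b≢a+2 : b ≈ i + 1ℤ → b ≢ a + 1ℤ + 1ℤ
      b≢a+2 b≈i+1 refl = x+1≉x (a + 1ℤ) (≈-trans b≈i+1 (≈-sym (+-congʳ-≈ 1ℤ a≈i)))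
    ... | no a≉i = ZP.≤-<-trans (S≤x a≉i) (<S a<b b≢a+1)
      where
      b≢a+1 : b ≈ i + 1ℤ → b ≢ a + 1ℤ
      b≢a+1 b≈i+1 refl = a≉i (+-cancelʳ-≈ 1ℤ b≈i+1)

    S-displacement : ∀ y → S y - y ≡ indicator i y - indicator (i + 1ℤ) y
    S-displacement y with position y
    ... | at-i y≈i = begin
      S y - y              ≡⟨ cong (_- y) (S-at-i y≈i) ⟩
      y + 1ℤ - y           ≡⟨ e y ⟩
      1ℤ - 0ℤ              ≡⟨ cong₂ _-_ (indicator-≈ y≈i) (indicator-≉ (i+1≉i y≈i)) ⟨
      indicator i y - indicator (i + 1ℤ) y ∎
      where
      open ≡-Reasoning
      e : ∀ (y : ℤ) → y + 1ℤ - y ≡ 1ℤ - 0ℤ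
      e = solve-∀
    ... | at-i+1 y≈i+1 = begin
      S y - y              ≡⟨ cong (_- y) (S-at-i+1 y≈i+1) ⟩
      y - 1ℤ - y           ≡⟨ e y ⟩
      0ℤ - 1ℤ              ≡⟨ cong₂ _-_ (indicator-≉ (λ y≈i → i+1≉i y≈i y≈i+1)) (indicator-≈ y≈i+1) ⟨
      indicator i y - indicator (i + 1ℤ) y ∎
      where
      open ≡-Reasoning
      e : ∀ (y : ℤ) → y - 1ℤ - y ≡ 0ℤ - 1ℤ
      e = solve-∀
    ... | elsewhere y≉i y≉i+1 = begin
      S y - y              ≡⟨ cong (_- y) (S-elsewhere y≉i y≉i+1) ⟩
      y - y                ≡⟨ ZP.+-inverseʳ y ⟩
      0ℤ - 0ℤ              ≡⟨ cong₂ _-_ (indicator-≉ y≉i) (indicator-≉ y≉i+1) ⟨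
      indicator i y - indicator (i + 1ℤ) y ∎
      where open ≡-Reasoning

    displacement-S : displacement S ≡ 0ℤ
    displacement-S = begin
      displacement S                                      ≡⟨ sumFrom1-cong n S-displacement ⟩
      sumFrom1 n (λ y → indicator i y - indicator (i + 1ℤ) y) ≡⟨ sumFrom1-- n _ _ ⟩
      sumFrom1 n (indicator i) - sumFrom1 n (indicator (i + 1ℤ))
        ≡⟨ cong₂ _-_ (sum-indicator-∘ IsAffPerm-id i) (sum-indicator-∘ IsAffPerm-id (i + 1ℤ)) ⟩
      1ℤ - 1ℤ                                             ≡⟨⟩
      0ℤ                                                  ∎
      where open ≡-Reasoning

  -- Conjugation by s_i

  module Conjugation (i : ℤ) {g g' : ℤ → ℤ} (g-aff : IsAffPerm n g)
                     (g'≗SgS : ∀ x → g' x ≡ s n i (g (s n i x))) where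

    open Reflection i
    private
      module G = AffPerm g-aff

    g'-aff : IsAffPerm n g'
    g'-aff = IsAffPerm-resp-≗ (λ x → sym (g'≗SgS x)) (IsAffPerm-∘ IsAffPerm-S (IsAffPerm-∘ g-aff IsAffPerm-S))

    displacement-conjugate : displacement g' ≡ displacement g
    displacement-conjugate = begin
      displacement g'                                ≡⟨ sumFrom1-cong n (λ x → cong (_- x) (g'≗SgS x)) ⟩
      displacement (λ x → S (g (S x)))               ≡⟨ displacement-∘ IsAffPerm-S (IsAffPerm-∘ g-aff IsAffPerm-S) ⟩
      displacement S + displacement (λ x → g (S x))  ≡⟨ cong₂ _+_ displacement-S (displacement-∘ g-aff IsAffPerm-S) ⟩
      0ℤ + (displacement g + displacement S)         ≡⟨ cong (λ w → 0ℤ + (displacement g + w)) displacement-S ⟩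
      0ℤ + (displacement g + 0ℤ)                     ≡⟨ e (displacement g) ⟩
      displacement g                                 ∎
      where
      open ≡-Reasoning
      e : ∀ (d : ℤ) → 0ℤ + (d + 0ℤ) ≡ d
      e = solve-∀

    g'∘S : ∀ w → g' (S w) ≡ S (g w)
    g'∘S w = trans (g'≗SgS (S w)) (cong (λ y → S (g y)) (S-involutive w))

    g'-at-i : ∀ {x} → x ≈ i → g' x ≡ S (g (x + 1ℤ))
    g'-at-i x≈i = trans (g'≗SgS _) (cong (λ y → S (g y)) (S-at-i x≈i))

    g'-after-i : ∀ {x} → x ≈ i → g' (x + 1ℤ) ≡ S (g x)
    g'-after-i x≈i = trans (g'≗SgS _) (cong (λ y → S (g y)) (S[x+1]≡x x≈i))

    p₀ : ℤ
    p₀ = residue i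

    p₀≈i : p₀ ≈ i
    p₀≈i = ≈-sym (≈-residue i)

    -- Conditions under which conjugation by S maps the inversions of g injectively to inversions
    -- of g' other than (p₀, p₀ + 1).
    record AddsInversion : Set where
      field
        ascent-at-i       : ∀ u → u ≈ i → g u Z.< g (u + 1ℤ)
        no-descent-onto-i : ∀ u v → u Z.< v → g v ≈ i → g u ≢ g v + 1ℤ
        descent-at-p₀     : g' (p₀ + 1ℤ) Z.< g' p₀

    module _ (adds : AddsInversion) where
      open AddsInversion adds

      offset : ℤ → ℤ
      offset u = _≈_.quotient (≈-residue (S u))

      residue-S : ∀ u → residue (S u) ≡ S u - offset u * N
      residue-S u = e (S u) (residue (S u)) (offset u) N (_≈_.equation (≈-residue (S u)))
        where
        e : ∀ (a r t N : ℤ) → a ≡ r + t * N → r ≡ a - t * N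
        e _ r t N refl = cancel r t N
          where
          cancel : ∀ (r t N : ℤ) → r ≡ r + t * N - t * N
          cancel = solve-∀

      -- The translation by a multiple of n brings the first entry back into [1, n].
      conj-pair : ℤ × ℤ → ℤ × ℤ
      conj-pair (u , v) = residue (S u) , S v - offset u * N

      conj-pair-Inversion : ∀ q → Inversion n g q → Inversion n g' (conj-pair q)
      conj-pair-Inversion (u , v) (_ , _ , u<v , gv<gu) =
        proj₁ (InRange-residue (S u)) , proj₂ (InRange-residue (S u)) ,
        subst (Z._< S v - tN) (sym (residue-S u)) (ZP.+-monoˡ-< (- tN) Su<Sv) ,
        subst₂ Z._<_ (sym g'-second) (sym g'-first) (ZP.+-monoˡ-< (- tN) Sgv<Sgu)
        where
        tN : ℤ
        tN = offset u * N
        Su<Sv : S u Z.< S v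
        Su<Sv = S-<-mono u<v λ (u≈i , v≡u+1) →
          ZP.<-asym gv<gu (subst (λ w → g u Z.< g w) (sym v≡u+1) (ascent-at-i u u≈i))
        Sgv<Sgu : S (g v) Z.< S (g u)
        Sgv<Sgu = S-<-mono gv<gu λ (gv≈i , gu≡gv+1) → no-descent-onto-i u v u<v gv≈i gu≡gv+1
        g'-second : g' (S v - tN) ≡ S (g v) - tN
        g'-second = trans (AffPerm.shift⁻ g'-aff (S v) (offset u)) (cong (_- tN) (g'∘S v))
        g'-first : g' (residue (S u)) ≡ S (g u) - tN
        g'-first = trans (cong g' (residue-S u))
                         (trans (AffPerm.shift⁻ g'-aff (S u) (offset u)) (cong (_- tN) (g'∘S u)))

      residue-S-injective : ∀ {u u'} → residue (S u) ≡ residue (S u') → u ≈ u'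
      residue-S-injective {u} {u'} eq =
        subst₂ _≈_ (S-involutive u) (S-involutive u') (AffPerm.resp-≈ IsAffPerm-S Su≈Su')
        where
        Su≈Su' : S u ≈ S u'
        Su≈Su' = ≈-trans (≈-residue (S u)) (subst (_≈ S u') (sym eq) (≈-sym (≈-residue (S u'))))

      conj-pair-injective : ∀ {q q'} → Inversion n g q → Inversion n g q' →
        conj-pair q ≡ conj-pair q' → q ≡ q'
      conj-pair-injective {u , v} {u' , v'} (1≤u , u≤N , _) (1≤u' , u'≤N , _) eq
        with refl ← InRange-≈⇒≡ (1≤u , u≤N) (1≤u' , u'≤N) (residue-S-injective (cong proj₁ eq)) =
        cong (u ,_) (begin
          v          ≡⟨ S-involutive v ⟨
          S (S v)    ≡⟨ cong S (+-cancelʳ (- (offset u * N)) (S v) (S v') (cong proj₂ eq)) ⟩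
          S (S v')   ≡⟨ S-involutive v' ⟩
          v'         ∎)
        where open ≡-Reasoning

      conj-pair-≢ : ∀ q → Inversion n g q → conj-pair q ≢ (p₀ , p₀ + 1ℤ)
      conj-pair-≢ (u , v) (_ , _ , u<v , _) eq = ZP.<-asym u<v (subst (v Z.<_) (sym u≡v+1) (i<i+1 v))
        where
        open ≡-Reasoning
        tN : ℤ
        tN = offset u * N
        Su-tN≡p₀ : S u - tN ≡ p₀
        Su-tN≡p₀ = trans (sym (residue-S u)) (cong proj₁ eq)
        Su≈i : S u ≈ i
        Su≈i = ≈-trans (≈-residue (S u)) (subst (_≈ i) (sym (cong proj₁ eq)) p₀≈i)
        Sv≡Su+1 : S v ≡ S u + 1ℤ
        Sv≡Su+1 = begin
          S v                    ≡⟨ e₁ (S v) tN ⟩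
          (S v - tN) + tN        ≡⟨ cong (_+ tN) (cong proj₂ eq) ⟩
          (p₀ + 1ℤ) + tN         ≡⟨ cong (λ w → (w + 1ℤ) + tN) Su-tN≡p₀ ⟨
          (S u - tN + 1ℤ) + tN   ≡⟨ e₂ (S u) tN ⟩
          S u + 1ℤ               ∎
          where
          e₁ : ∀ (a b : ℤ) → a ≡ (a - b) + b
          e₁ = solve-∀
          e₂ : ∀ (a b : ℤ) → (a - b + 1ℤ) + b ≡ a + 1ℤ
          e₂ = solve-∀
        u≡v+1 : u ≡ v + 1ℤ
        u≡v+1 = begin
          u                  ≡⟨ S-involutive u ⟨
          S (S u)            ≡⟨ S-at-i Su≈i ⟩
          S u + 1ℤ           ≡⟨ cong (_+ 1ℤ) (e (S u)) ⟩
          (S u + 1ℤ - 1ℤ) + 1ℤ ≡⟨ cong (_+ 1ℤ) (S-at-i+1 (+-congʳ-≈ 1ℤ Su≈i)) ⟨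
          S (S u + 1ℤ) + 1ℤ  ≡⟨ cong (λ w → S w + 1ℤ) Sv≡Su+1 ⟨
          S (S v) + 1ℤ       ≡⟨ cong (_+ 1ℤ) (S-involutive v) ⟩
          v + 1ℤ             ∎
          where
          e : ∀ (a : ℤ) → a ≡ a + 1ℤ - 1ℤ
          e = solve-∀

      length-increases : ∀ {a b} → HasLength n g' a → HasLength n g b → b ℕ.< a
      length-increases (L' , _ , |L'|≡a , L'-inversions) (L , L! , |L|≡b , L-inversions) =
        subst₂ ℕ._<_ |L|≡b |L'|≡a
          (length-<-by-injection conj-pair L!
            (λ q∈L q'∈L → conj-pair-injective (inversion q∈L) (inversion q'∈L))
            (λ q∈L → Equivalence.from (L'-inversions _) (conj-pair-Inversion _ (inversion q∈L)))
            (Equivalence.from (L'-inversions _)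
              (proj₁ (InRange-residue i) , proj₂ (InRange-residue i) , i<i+1 p₀ , descent-at-p₀))
            (λ q∈L → conj-pair-≢ _ (inversion q∈L)))
        where
        inversion : ∀ {q} → q ∈ L → Inversion n g q
        inversion = Equivalence.to (L-inversions _)

    Boundary : Set
    Boundary = ∃[ p ] p ≈ i × (g p ≡ p + 1ℤ ⊎ g (p + 1ℤ) ≡ p + N)

    module _ (g-strict : StrictWindow g) where

      Window-or-Boundary-at-i : ∀ {x} → x ≈ i → InWindow x (g' x) ⊎ Boundary
      Window-or-Boundary-at-i {x} x≈i with g (x + 1ℤ) ZP.≟ x + N
      ... | yes g[x+1]≡x+N = inj₂ (x , x≈i , inj₂ g[x+1]≡x+N)
      ... | no  g[x+1]≢x+N = inj₁ (subst (InWindow x) (sym g'x≡) (S-inside x<z z<x+N))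
        where
        g'x≡ : g' x ≡ S (g (x + 1ℤ))
        g'x≡ = g'-at-i x≈i
        x<z : x Z.< g (x + 1ℤ)
        x<z = ZP.<-trans (i<i+1 x) (proj₁ (g-strict (x + 1ℤ)))
        z<x+N : g (x + 1ℤ) Z.< x + N
        z<x+N = ZP.≤∧≢⇒< (i<j+1⇒i≤j (subst (g (x + 1ℤ) Z.<_) (e x N) (proj₂ (g-strict (x + 1ℤ))))) g[x+1]≢x+N
          where
          e : ∀ (x N : ℤ) → x + 1ℤ + N ≡ x + N + 1ℤ
          e = solve-∀

      Window-or-Boundary-at-i+1 : ∀ {x} → x ≈ i + 1ℤ → InWindow x (g' x) ⊎ Boundary
      Window-or-Boundary-at-i+1 {x} x≈i+1 with g (x - 1ℤ) ZP.≟ x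
      ... | yes g[x-1]≡x = inj₂ (x - 1ℤ , -1≈i x≈i+1 , inj₁ (trans g[x-1]≡x (e x)))
        where
        e : ∀ (x : ℤ) → x ≡ x - 1ℤ + 1ℤ
        e = solve-∀
      ... | no  g[x-1]≢x = inj₁ (subst (InWindow x) (sym g'x≡) (S-inside x<z z<x+N))
        where
        g'x≡ : g' x ≡ S (g (x - 1ℤ))
        g'x≡ = trans (g'≗SgS x) (cong (λ y → S (g y)) (S-at-i+1 x≈i+1))
        x<z : x Z.< g (x - 1ℤ)
        x<z = ZP.≤∧≢⇒< (subst (Z._≤ g (x - 1ℤ)) (e x) (i<j⇒i+1≤j (proj₁ (g-strict (x - 1ℤ)))))
                       (λ x≡z → g[x-1]≢x (sym x≡z))
          where
          e : ∀ (x : ℤ) → x - 1ℤ + 1ℤ ≡ x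
          e = solve-∀
        z<x+N : g (x - 1ℤ) Z.< x + N
        z<x+N = ZP.<-trans (subst (g (x - 1ℤ) Z.<_) (e x N) (proj₂ (g-strict (x - 1ℤ)))) (i-1<i (x + N))
          where
          e : ∀ (x N : ℤ) → x - 1ℤ + N ≡ x + N - 1ℤ
          e = solve-∀

      Window-or-Boundary : ∀ x → InWindow x (g' x) ⊎ Boundary
      Window-or-Boundary x with position x
      ... | at-i x≈i            = Window-or-Boundary-at-i x≈i
      ... | at-i+1 x≈i+1        = Window-or-Boundary-at-i+1 x≈i+1
      ... | elsewhere x≉i x≉i+1 =
        inj₁ (subst (InWindow x) (sym g'x≡) (S-inside (proj₁ (g-strict x)) (proj₂ (g-strict x))))
        where
        g'x≡ : g' x ≡ S (g x)
        g'x≡ = trans (g'≗SgS x) (cong (λ y → S (g y)) (S-elsewhere x≉i x≉i+1))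

      AddsInversion-of-g[p]≡p+1 : ∀ {p} → p ≈ i → g p ≡ p + 1ℤ → AddsInversion
      AddsInversion-of-g[p]≡p+1 {p} p≈i gp≡p+1 = record
        { ascent-at-i       = ascent
        ; no-descent-onto-i = no-descent
        ; descent-at-p₀     = descent
        }
        where
        step : ∀ {u} → u ≈ i → g u ≡ u + 1ℤ
        step u≈i = G.displacement-on-class (≈-trans u≈i (≈-sym p≈i)) gp≡p+1
        ascent : ∀ u → u ≈ i → g u Z.< g (u + 1ℤ)
        ascent u u≈i = subst (Z._< g (u + 1ℤ)) (sym (step u≈i)) (proj₁ (g-strict (u + 1ℤ)))
        no-descent : ∀ u v → u Z.< v → g v ≈ i → g u ≢ g v + 1ℤ
        no-descent u v u<v gv≈i gu≡gv+1 = ZP.<-asym u<v (subst (v Z.<_) gv≡u (proj₁ (g-strict v)))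
          where
          u≈i : u ≈ i
          u≈i = ≈-trans (G.≈-injective (≈-trans (≈-reflexive gu≡gv+1)
                  (≈-trans (+-congʳ-≈ 1ℤ (≈-trans gv≈i (≈-sym p≈i))) (≈-reflexive (sym gp≡p+1))))) p≈i
          gv≡u : g v ≡ u
          gv≡u = +-cancelʳ 1ℤ (g v) u (trans (sym gu≡gv+1) (step u≈i))
        descent : g' (p₀ + 1ℤ) Z.< g' p₀
        descent = begin-strict
          g' (p₀ + 1ℤ)          ≡⟨ g'-after-i p₀≈i ⟩
          S (g p₀)              ≡⟨ cong S (step p₀≈i) ⟩
          S (p₀ + 1ℤ)           ≡⟨ S[x+1]≡x p₀≈i ⟩
          p₀                    <⟨ i+1≤j⇒i<j (i<j⇒i≤j-1 (proj₁ (g-strict (p₀ + 1ℤ)))) ⟩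
          g (p₀ + 1ℤ) - 1ℤ      ≤⟨ x-1≤S _ ⟩
          S (g (p₀ + 1ℤ))       ≡⟨ g'-at-i p₀≈i ⟨
          g' p₀                 ∎
          where open ZP.≤-Reasoning

      AddsInversion-of-g[p+1]≡p+N : ∀ {p} → p ≈ i → g (p + 1ℤ) ≡ p + N → AddsInversion
      AddsInversion-of-g[p+1]≡p+N {p} p≈i g[p+1]≡p+N = record
        { ascent-at-i       = ascent
        ; no-descent-onto-i = no-descent
        ; descent-at-p₀     = descent
        }
        where
        e : ∀ (u N : ℤ) → u + N ≡ (u + 1ℤ) + (N - 1ℤ)
        e = solve-∀
        step : ∀ {w} → w ≈ p + 1ℤ → g w ≡ w + (N - 1ℤ)
        step w≈p+1 = G.displacement-on-class w≈p+1 (trans g[p+1]≡p+N (e p N))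
        g[u+1]≡u+N : ∀ {u} → u ≈ i → g (u + 1ℤ) ≡ u + N
        g[u+1]≡u+N {u} u≈i = trans (step (+-congʳ-≈ 1ℤ (≈-trans u≈i (≈-sym p≈i)))) (sym (e u N))
        ascent : ∀ u → u ≈ i → g u Z.< g (u + 1ℤ)
        ascent u u≈i = subst (g u Z.<_) (sym (g[u+1]≡u+N u≈i)) (proj₂ (g-strict u))
        no-descent : ∀ u v → u Z.< v → g v ≈ i → g u ≢ g v + 1ℤ
        no-descent u v u<v gv≈i gu≡gv+1 = ZP.<-irrefl refl (begin-strict
          v + N                       ≡⟨ e' v N ⟩
          (v + (N - 1ℤ)) + 1ℤ         ≡⟨ cong (_+ 1ℤ) (step v≈p+1) ⟨
          g v + 1ℤ                    ≡⟨ gu≡gv+1 ⟨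
          g u                         <⟨ proj₂ (g-strict u) ⟩
          u + N                       <⟨ ZP.+-monoˡ-< N u<v ⟩
          v + N                       ∎)
          where
          open ZP.≤-Reasoning
          e' : ∀ (v N : ℤ) → v + N ≡ (v + (N - 1ℤ)) + 1ℤ
          e' = solve-∀
          v≈p+1 : v ≈ p + 1ℤ
          v≈p+1 = G.≈-injective (≈-trans gv≈i (≈-trans (≈-sym p≈i)
                    (≈-trans (≈-sym (x+N≈x p)) (≈-reflexive (sym g[p+1]≡p+N)))))
        descent : g' (p₀ + 1ℤ) Z.< g' p₀
        descent = begin-strict
          g' (p₀ + 1ℤ)          ≡⟨ g'-after-i p₀≈i ⟩
          S (g p₀)              ≤⟨ S≤x+1 (g p₀) ⟩
          g p₀ + 1ℤ             <⟨ ZP.+-monoˡ-< 1ℤ (proj₂ (g-strict p₀)) ⟩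
          p₀ + N + 1ℤ           ≡⟨ S-at-i (≈-trans (x+N≈x p₀) p₀≈i) ⟨
          S (p₀ + N)            ≡⟨ cong S (g[u+1]≡u+N p₀≈i) ⟨
          S (g (p₀ + 1ℤ))       ≡⟨ g'-at-i p₀≈i ⟨
          g' p₀                 ∎
          where open ZP.≤-Reasoning

      Boundary⇒AddsInversion : Boundary → AddsInversion
      Boundary⇒AddsInversion (p , p≈i , inj₁ gp≡p+1)     = AddsInversion-of-g[p]≡p+1 p≈i gp≡p+1
      Boundary⇒AddsInversion (p , p≈i , inj₂ g[p+1]≡p+N) = AddsInversion-of-g[p+1]≡p+N p≈i g[p+1]≡p+N

    Θ-conjugate : ∀ {k a b} → Θ k n g → HasLength n g' a → HasLength n g b → a ℕ.≤ b → Θ k n g'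
    Θ-conjugate {k} g∈Θ@(_ , _ , g-displacement , g-cycle) ℓ[g']≡a ℓ[g]≡b a≤b =
      g'-aff , window , trans displacement-conjugate g-displacement , InducedNCycle-conjugate IsAffPerm-S g'≗SgS g-cycle
      where
      g-strict : StrictWindow g
      g-strict = Θ⇒StrictWindow {k} g∈Θ
      window : ∀ x → InWindow x (g' x)
      window x with Window-or-Boundary g-strict x
      ... | inj₁ in-window = in-window
      ... | inj₂ boundary  = ⊥-elim (ℕP.<⇒≱ (length-increases (Boundary⇒AddsInversion g-strict boundary) ℓ[g']≡a ℓ[g]≡b) a≤b)

lemma2p4 : (k n : ℕ) → 1 ≤ k → k ≤ n ∸ 1 →
    (f f' : ℤ → ℤ) → Θ k n f → IsAffPerm n f' →
    (r : ℕ) → (fs : ℕ → ℤ → ℤ) →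
    (∀ j → j ≤ r → IsAffPerm n (fs j)) →
    (∀ x → fs 0 x ≡ f x) → (∀ x → fs r x ≡ f' x) →
    (∀ j → 1 ≤ j → j ≤ r →
      (∃[ i ] (∀ x → fs j x ≡ s n i (fs (j ∸ 1) (s n i x))))
      × (∃[ a ] ∃[ b ] (HasLength n (fs j) a × HasLength n (fs (j ∸ 1)) b × a ≤ b))) →
    Θ k n f'
lemma2p4 k n 1≤k k≤n-1 f f' f∈Θ _ r fs _ fs₀≗f fsᵣ≗f' steps = Θ-resp-≗ {k} fsᵣ≗f' (fs∈Θ r ℕP.≤-refl)
  where
  -- The bounds on k only serve to force n ≥ 2.
  1<n : 1 ℕ.< n
  1<n = ℕP.m∸n≢0⇒n<m (λ n-1≡0 → ℕP.<⇒≢ (ℕP.≤-trans 1≤k k≤n-1) (sym n-1≡0))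
  open AffineSymmetricGroup n 1<n
  fs∈Θ : ∀ j → j ≤ r → Θ k n (fs j)
  fs∈Θ zero    _     = Θ-resp-≗ {k} (λ x → sym (fs₀≗f x)) f∈Θ
  fs∈Θ (suc j) 1+j≤r
    with (i , fs[1+j]≗s∘fsⱼ∘s) , (_ , _ , ℓ[fs[1+j]]≡a , ℓ[fsⱼ]≡b , a≤b) ← steps (suc j) (ℕ.s≤s ℕ.z≤n) 1+j≤r =
    Conjugation.Θ-conjugate i (proj₁ fsⱼ∈Θ) fs[1+j]≗s∘fsⱼ∘s {k} fsⱼ∈Θ ℓ[fs[1+j]]≡a ℓ[fsⱼ]≡b a≤b
    where
    fsⱼ∈Θ : Θ k n (fs j)
    fsⱼ∈Θ = fs∈Θ j (ℕP.≤-trans (ℕP.n≤1+n j) 1+j≤r)
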